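{- Let $r$ be a request sequence and $k$ a positive integer. Then for every integer $k'\ge k+2\,m_k(r)$, \[\ell_{k'}(r)\le \tfrac34\,\ell_k(r).\]
   Context: A request sequence is a finite sequence of nodes. For a positive integer $k$, the $k$-phases of $r$ are defined as follows: the first $k$-phase is the longest prefix of $r$ containing requests to at most $k$ distinct nodes; in general the $i$-th $k$-phase is the longest block of consecutive requests beginning with the request (if any) following the $(i-1)$-st $k$-phase and containing requests to at most $k$ distinct nodes. $\ell_k(r)$ denotes the number of $k$-phases of $r$ minus $1$. In a $k$-phase other than the first, a new request is a request to a node not requested previously in that $k$-phase nor in the previous $k$-phase. $m_k(r)$ denotes the average number of new requests per $k$-phase over the $k$-phases other than the first, i.e. the total number of new requests divided by $\ell_k(r)$ (with $m_k(r)=0$ if $\ell_k(r)=0$). -}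

module Defs where

open import Data.Bool using (Bool; true; false; if_then_else_; _∨_)
open import Data.List using (List; []; _∷_; _++_; [_]; length)
open import Data.List.Relation.Unary.Any using (any?)
open import Data.Nat using (ℕ; zero; suc; _∸_; _<ᵇ_; _+_)
open import Data.Integer using (+_)
open import Data.Rational using (ℚ; _/_; 0ℚ)
open import Relation.Nullary.Decidable using (does)
open import Relation.Binary.Definitions using (DecidableEquality)

module Phases {A : Set} (_≟_ : DecidableEquality A) where

  _∈ᵇ_ : A → List A → Bool
  x ∈ᵇ xs = does (any? (x ≟_) xs)

  -- Greedy splitting of r into k-phases.
  -- seen  : distinct nodes requested in the current phase
  -- block : requests of the current phase (in order)
  phasesGo : ℕ → List A → List A → List A → List (List A)
  phasesGo k seen [] [] = []
  phasesGo k seen (b ∷ bs) [] = (b ∷ bs) ∷ []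
  phasesGo k seen block (x ∷ xs) with x ∈ᵇ seen
  ... | true = phasesGo k seen (block ++ [ x ]) xs
  ... | false with length seen <ᵇ k
  ...   | true = phasesGo k (x ∷ seen) (block ++ [ x ]) xs
  ...   | false = block ∷ phasesGo k [ x ] [ x ] xs

  phases : ℕ → List A → List (List A)
  phases k r = phasesGo k [] [] r

  ℓ : ℕ → List A → ℕ
  ℓ k r = length (phases k r) ∸ 1

  newIn : List A → List A → List A → ℕ
  newIn prev earlier [] = 0
  newIn prev earlier (x ∷ xs) =
    (if (x ∈ᵇ earlier) ∨ (x ∈ᵇ prev) then 0 else 1) + newIn prev (earlier ++ [ x ]) xs

  totalNew : List (List A) → ℕ
  totalNew (p ∷ q ∷ ps) = newIn p [] q + totalNew (q ∷ ps)
  totalNew _ = 0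

  m : ℕ → List A → ℚ
  m k r with ℓ k r
  ... | zero = 0ℚ
  ... | suc n = (+ totalNew (phases k r)) / suc n

module Submission where

-- Let d = k′ − k and split r into its k-phases P₀, …, P_ℓ. Scanning from the left, merge a
-- phase with its successor whenever the successor has at most d new requests; a merged pair
-- requests at most k + d ≤ k′ distinct nodes, so r is cut into blocks each fitting k′ nodes.
-- A phase left unmerged (except possibly the last) is followed by more than d new requests,
-- while the hypothesis says there are only ℓ·m_k ≤ ℓd/2 new requests in total; counting gives
-- at most 3ℓ/4 + 1 blocks. Finally, the greedy k′-phases are optimal: every cut of r into
-- blocks of at most k′ distinct nodes has at least as many blocks, since the j-th greedy phase
-- never ends before the j-th block does.

import Relation.Binary.Definitions

module Arithmetic where
  open import Data.Nat using (zero; suc; _+_; _*_; _∸_; _≤_; z≤n; s≤s)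
  open import Data.Nat.Properties
  open import Data.Nat.Tactic.RingSolver using (solve-∀)
  open import Data.Product using (_×_; _,_)
  open import Relation.Binary.PropositionalEquality using (_≡_; subst)

  budget-split : ∀ k k′ T s → suc s * k + 2 * T ≤ suc s * k′ → k ≤ k′ × 2 * T ≤ suc s * (k′ ∸ k)
  budget-split k k′ T s h = *-cancelˡ-≤ (suc s) (≤-trans (m≤m+n _ _) h) , (begin
    2 * T                   ≤⟨ m+n≤o⇒m≤o∸n (2 * T) (subst (_≤ suc s * k′) (+-comm (suc s * k) (2 * T)) h) ⟩
    suc s * k′ ∸ suc s * k  ≡⟨ *-distribˡ-∸ (suc s) k′ k ⟨
    suc s * (k′ ∸ k)        ∎)
    where open ≤-Reasoning

  2[1+n]+[n∸1]≤4+3[n∸1] : ∀ n → 2 * suc n + (n ∸ 1) ≤ 4 + 3 * (n ∸ 1)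
  2[1+n]+[n∸1]≤4+3[n∸1] zero    = s≤s (s≤s z≤n)
  2[1+n]+[n∸1]≤4+3[n∸1] (suc m) = ≤-reflexive (regroup m)
    where
    regroup : ∀ m → 2 * suc (suc m) + m ≡ 4 + 3 * m
    regroup = solve-∀

  pairing-bound : ∀ d n G T → G * (2 * suc d) ≤ suc n * suc d + T → 2 * T ≤ (n ∸ 1) * d →
                  4 * (G ∸ 1) ≤ 3 * (n ∸ 1)
  pairing-bound d n G T pairs new = begin
    4 * (G ∸ 1)  ≡⟨ *-distribˡ-∸ 4 G 1 ⟩
    4 * G ∸ 4    ≤⟨ m≤n+o⇒m∸n≤o (4 * G) 4 (*-cancelʳ-≤ (4 * G) (4 + 3 * ℓ) D scaled) ⟩
    3 * ℓ        ∎
    where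
    open ≤-Reasoning
    D = suc d
    ℓ = n ∸ 1
    scaled : 4 * G * D ≤ (4 + 3 * ℓ) * D
    scaled = begin
      4 * G * D                ≡⟨ double G D ⟩
      2 * (G * (2 * D))        ≤⟨ *-monoʳ-≤ 2 pairs ⟩
      2 * (suc n * D + T)      ≡⟨ *-distribˡ-+ 2 (suc n * D) T ⟩
      2 * (suc n * D) + 2 * T  ≤⟨ +-monoʳ-≤ (2 * (suc n * D)) (≤-trans new (*-monoʳ-≤ ℓ (n≤1+n d))) ⟩
      2 * (suc n * D) + ℓ * D  ≡⟨ factor n D ℓ ⟩
      (2 * suc n + ℓ) * D      ≤⟨ *-monoˡ-≤ D (2[1+n]+[n∸1]≤4+3[n∸1] n) ⟩
      (4 + 3 * ℓ) * D          ∎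
      where
      double : ∀ G D → 4 * G * D ≡ 2 * (G * (2 * D))
      double = solve-∀
      factor : ∀ n D ℓ → 2 * (suc n * D) + ℓ * D ≡ (2 * suc n + ℓ) * D
      factor = solve-∀

module Fractions where
  open import Data.Nat as ℕ using (suc)
  open import Data.Nat.Properties using (*-comm; *-identityʳ)
  open import Data.Nat.Tactic.RingSolver using (solve-∀)
  open import Data.Integer as ℤ using (+_; +≤+)
  open import Data.Integer.Properties using (pos-+; pos-*; drop‿+≤+)
  open import Data.Rational using (_/_; _+_; _*_; _≤_; toℚᵘ)
  open import Data.Rational.Properties
    using (toℚᵘ-fromℚᵘ; toℚᵘ-mono-≤; toℚᵘ-cancel-≤; toℚᵘ-homo-+; toℚᵘ-homo-*)
  open import Data.Rational.Unnormalised as ℚᵘ using (mkℚᵘ; *≤*; _≃_)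
  open import Data.Rational.Unnormalised.Properties as ℚᵘ using (≃-trans; +-cong; *-cong)
  open import Relation.Binary.PropositionalEquality
    using (_≡_; sym; trans; cong; cong₂; subst₂; module ≡-Reasoning)

  toℚᵘ-/ : ∀ i d → toℚᵘ (i / suc d) ≃ mkℚᵘ i d
  toℚᵘ-/ i d = toℚᵘ-fromℚᵘ (mkℚᵘ i d)

  mkℚᵘ-+ : ∀ a b c e →
    mkℚᵘ (+ a) b ℚᵘ.+ mkℚᵘ (+ c) e ≡ mkℚᵘ (+ (a ℕ.* suc e ℕ.+ c ℕ.* suc b)) (e ℕ.+ b ℕ.* suc e)
  mkℚᵘ-+ a b c e = cong (λ i → mkℚᵘ i (e ℕ.+ b ℕ.* suc e)) (begin
    + a ℤ.* + suc e ℤ.+ + c ℤ.* + suc b  ≡⟨ cong₂ ℤ._+_ (pos-* a (suc e)) (pos-* c (suc b)) ⟨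
    + (a ℕ.* suc e) ℤ.+ + (c ℕ.* suc b)  ≡⟨ pos-+ (a ℕ.* suc e) (c ℕ.* suc b) ⟨
    + (a ℕ.* suc e ℕ.+ c ℕ.* suc b)      ∎)
    where open ≡-Reasoning

  mkℚᵘ-* : ∀ a b c e → mkℚᵘ (+ a) b ℚᵘ.* mkℚᵘ (+ c) e ≡ mkℚᵘ (+ (a ℕ.* c)) (e ℕ.+ b ℕ.* suc e)
  mkℚᵘ-* a b c e = cong (λ i → mkℚᵘ i (e ℕ.+ b ℕ.* suc e)) (sym (pos-* a c))

  mkℚᵘ-≤⁺ : ∀ {a b c e} → a ℕ.* suc e ℕ.≤ c ℕ.* suc b → mkℚᵘ (+ a) b ℚᵘ.≤ mkℚᵘ (+ c) e
  mkℚᵘ-≤⁺ {a} {b} {c} {e} h = *≤* (subst₂ ℤ._≤_ (pos-* a (suc e)) (pos-* c (suc b)) (+≤+ h))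

  mkℚᵘ-≤⁻ : ∀ {a b c e} → mkℚᵘ (+ a) b ℚᵘ.≤ mkℚᵘ (+ c) e → a ℕ.* suc e ℕ.≤ c ℕ.* suc b
  mkℚᵘ-≤⁻ {a} {b} {c} {e} (*≤* h) =
    drop‿+≤+ (subst₂ ℤ._≤_ (sym (pos-* a (suc e))) (sym (pos-* c (suc b))) h)

  fraction-budget : ∀ k k′ T n → (+ k / 1) + (+ 2 / 1) * (+ T / suc n) ≤ (+ k′ / 1) →
                    suc n ℕ.* k ℕ.+ 2 ℕ.* T ℕ.≤ suc n ℕ.* k′
  fraction-budget k k′ T n H = subst₂ ℕ._≤_ (lhs-nf k n T) (rhs-nf k′ n) (mkℚᵘ-≤⁻ (begin
    mkℚᵘ (+ (k ℕ.* suc (n ℕ.+ 0) ℕ.+ 2 ℕ.* T ℕ.* 1)) (n ℕ.+ 0 ℕ.+ 0)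
      ≡⟨ trans (cong (mkℚᵘ (+ k) 0 ℚᵘ.+_) (mkℚᵘ-* 2 0 T n)) (mkℚᵘ-+ k 0 (2 ℕ.* T) (n ℕ.+ 0)) ⟨
    mkℚᵘ (+ k) 0 ℚᵘ.+ mkℚᵘ (+ 2) 0 ℚᵘ.* mkℚᵘ (+ T) n
      ≃⟨ ≃-trans (toℚᵘ-homo-+ (+ k / 1) ((+ 2 / 1) * (+ T / suc n)))
           (+-cong (toℚᵘ-/ (+ k) 0)
             (≃-trans (toℚᵘ-homo-* (+ 2 / 1) (+ T / suc n))
               (*-cong (toℚᵘ-/ (+ 2) 0) (toℚᵘ-/ (+ T) n)))) ⟨
    toℚᵘ ((+ k / 1) + (+ 2 / 1) * (+ T / suc n))
      ≤⟨ toℚᵘ-mono-≤ H ⟩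
    toℚᵘ (+ k′ / 1)
      ≃⟨ toℚᵘ-/ (+ k′) 0 ⟩
    mkℚᵘ (+ k′) 0 ∎))
    where
    open ℚᵘ.≤-Reasoning
    lhs-nf : ∀ k n T → (k ℕ.* suc (n ℕ.+ 0) ℕ.+ 2 ℕ.* T ℕ.* 1) ℕ.* 1 ≡ suc n ℕ.* k ℕ.+ 2 ℕ.* T
    lhs-nf = solve-∀
    rhs-nf : ∀ k′ n → k′ ℕ.* suc (n ℕ.+ 0 ℕ.+ 0) ≡ suc n ℕ.* k′
    rhs-nf = solve-∀

  ≤-three-quarters : ∀ a L → 4 ℕ.* a ℕ.≤ 3 ℕ.* L → (+ a / 1) ≤ (+ 3 / 4) * (+ L / 1)
  ≤-three-quarters a L h = toℚᵘ-cancel-≤ (begin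
    toℚᵘ (+ a / 1)                  ≃⟨ toℚᵘ-/ (+ a) 0 ⟩
    mkℚᵘ (+ a) 0
      ≤⟨ mkℚᵘ-≤⁺ (subst₂ ℕ._≤_ (*-comm 4 a) (sym (*-identityʳ (3 ℕ.* L))) h) ⟩
    mkℚᵘ (+ (3 ℕ.* L)) 3            ≡⟨ mkℚᵘ-* 3 3 L 0 ⟨
    mkℚᵘ (+ 3) 3 ℚᵘ.* mkℚᵘ (+ L) 0
      ≃⟨ ≃-trans (toℚᵘ-homo-* (+ 3 / 4) (+ L / 1)) (*-cong (toℚᵘ-/ (+ 3) 3) (toℚᵘ-/ (+ L) 0)) ⟨
    toℚᵘ ((+ 3 / 4) * (+ L / 1))    ∎)
    where open ℚᵘ.≤-Reasoning

module Pigeonhole {A : Set} where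
  open import Data.List using (List; []; _∷_; _++_; length)
  open import Data.List.Properties using (length-++)
  open import Data.List.Relation.Unary.All as All using (All; []; _∷_)
  open import Data.List.Relation.Unary.AllPairs using ([]; _∷_)
  open import Data.List.Relation.Unary.Any using (here; there)
  open import Data.List.Relation.Unary.Unique.Propositional using (Unique)
  open import Data.List.Membership.Propositional using (_∈_)
  open import Data.List.Membership.Propositional.Properties using (∈-∃++)
  open import Data.Nat using (suc; _+_; _≤_; z≤n; s≤s)
  open import Data.Nat.Properties using (+-suc; module ≤-Reasoning)
  open import Data.Product using (_,_)
  open import Relation.Nullary using (contradiction)
  open import Relation.Binary.PropositionalEquality using (_≢_; refl; sym; cong)

  ∈-delete : ∀ {x y : A} ys zs → x ≢ y → y ∈ ys ++ x ∷ zs → y ∈ ys ++ zs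
  ∈-delete []       zs x≢y (here y≡x) = contradiction (sym y≡x) x≢y
  ∈-delete []       zs x≢y (there y∈) = y∈
  ∈-delete (w ∷ ys) zs x≢y (here y≡w) = here y≡w
  ∈-delete (w ∷ ys) zs x≢y (there y∈) = there (∈-delete ys zs x≢y y∈)

  Unique⇒length≤ : ∀ {xs S : List A} → Unique xs → All (_∈ S) xs → length xs ≤ length S
  Unique⇒length≤ [] [] = z≤n
  Unique⇒length≤ {x ∷ xs} (x≢xs ∷ uniq) (x∈S ∷ xs⊆S) with ∈-∃++ x∈S
  ... | ys , zs , refl = begin
    suc (length xs)              ≤⟨ s≤s (Unique⇒length≤ uniq xs⊆ys++zs) ⟩
    suc (length (ys ++ zs))      ≡⟨ cong suc (length-++ ys) ⟩
    suc (length ys + length zs)  ≡⟨ +-suc (length ys) (length zs) ⟨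
    length ys + length (x ∷ zs)  ≡⟨ length-++ ys ⟨
    length (ys ++ x ∷ zs)        ∎
    where
    open ≤-Reasoning
    xs⊆ys++zs : All (_∈ ys ++ zs) xs
    xs⊆ys++zs = All.zipWith (λ (x≢y , y∈) → ∈-delete ys zs x≢y y∈) (x≢xs , xs⊆S)

module PhaseBounds {A : Set} (_≟_ : Relation.Binary.Definitions.DecidableEquality A) where
  open import Defs
  open import Data.List using (List; []; _∷_; _++_; [_]; length; concat)
  open import Data.List.Properties using (++-assoc)
  open import Data.List.Relation.Unary.All as All using (All; []; _∷_)
  open import Data.List.Relation.Unary.All.Properties using (++⁺; ¬Any⇒All¬)
  open import Data.List.Relation.Unary.Any using (here; there)
  open import Data.List.Relation.Unary.AllPairs using ([]; _∷_)
  open import Data.List.Relation.Unary.Unique.Propositional using (Unique)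
  open import Data.List.Membership.Propositional using (_∈_; _∉_)
  open import Data.List.Membership.DecPropositional _≟_ using (_∈?_)
  open import Data.List.Relation.Binary.Subset.Propositional using (_⊆_)
  open import Data.Nat using (ℕ; zero; suc; _+_; _*_; _∸_; _≤_; _<_; z≤n; s≤s)
  open import Data.Nat.Properties hiding (_≟_)
  open import Data.Nat.Tactic.RingSolver using (solve-∀)
  open import Data.Integer using (+_)
  import Data.Rational as ℚ
  open import Data.Product using (∃-syntax; _×_; _,_; proj₁)
  open import Function using (id; _∘_)
  open import Relation.Nullary using (yes; no; ¬_; contradiction)
  open import Relation.Nullary.Decidable using (dec-true; dec-false)
  open import Relation.Binary.PropositionalEquality using (_≡_; refl; sym; trans; cong; subst)
  open Arithmetic using (budget-split; pairing-bound)
  open Fractions using (fraction-budget)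
  open Pigeonhole using (Unique⇒length≤)
  open Phases _≟_

  Fits : ℕ → List A → Set
  Fits k xs = ∃[ S ] length S ≤ k × All (_∈ S) xs

  fits-mono : ∀ {k k′ xs} → k ≤ k′ → Fits k xs → Fits k′ xs
  fits-mono k≤k′ (S , S≤k , xs⊆S) = S , ≤-trans S≤k k≤k′ , xs⊆S

  phasesGo-revisit : ∀ k {seen x} block xs → x ∈ seen →
                     phasesGo k seen block (x ∷ xs) ≡ phasesGo k seen (block ++ [ x ]) xs
  phasesGo-revisit k {seen} {x} []      xs x∈ rewrite dec-true (x ∈? seen) x∈ = refl
  phasesGo-revisit k {seen} {x} (_ ∷ _) xs x∈ rewrite dec-true (x ∈? seen) x∈ = refl

  phasesGo-admit : ∀ k {seen x} block xs → x ∉ seen → length seen < k →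
                   phasesGo k seen block (x ∷ xs) ≡ phasesGo k (x ∷ seen) (block ++ [ x ]) xs
  phasesGo-admit k {seen} {x} []      xs x∉ room
    rewrite dec-false (x ∈? seen) x∉ | dec-true (length seen <? k) room = refl
  phasesGo-admit k {seen} {x} (_ ∷ _) xs x∉ room
    rewrite dec-false (x ∈? seen) x∉ | dec-true (length seen <? k) room = refl

  phasesGo-close : ∀ k {seen x} block xs → x ∉ seen → ¬ length seen < k →
                   phasesGo k seen block (x ∷ xs) ≡ block ∷ phasesGo k [ x ] [ x ] xs
  phasesGo-close k {seen} {x} []      xs x∉ full
    rewrite dec-false (x ∈? seen) x∉ | dec-false (length seen <? k) full = refl
  phasesGo-close k {seen} {x} (_ ∷ _) xs x∉ full
    rewrite dec-false (x ∈? seen) x∉ | dec-false (length seen <? k) full = refl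

  concat-phasesGo : ∀ k seen block xs → concat (phasesGo k seen block xs) ≡ block ++ xs
  concat-phasesGo k seen block   (x ∷ xs) with x ∈? seen | length seen <? k
  ... | yes x∈ | _ rewrite phasesGo-revisit k block xs x∈ =
    trans (concat-phasesGo k seen (block ++ [ x ]) xs) (++-assoc block [ x ] xs)
  ... | no x∉ | yes room rewrite phasesGo-admit k block xs x∉ room =
    trans (concat-phasesGo k (x ∷ seen) (block ++ [ x ]) xs) (++-assoc block [ x ] xs)
  ... | no x∉ | no full rewrite phasesGo-close k block xs x∉ full =
    cong (block ++_) (concat-phasesGo k [ x ] [ x ] xs)
  concat-phasesGo k seen []      []       = refl
  concat-phasesGo k seen (_ ∷ _) []       = refl

  phasesGo-fits : ∀ {k} → 1 ≤ k → ∀ seen block xs → length seen ≤ k → All (_∈ seen) block →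
                  All (Fits k) (phasesGo k seen block xs)
  phasesGo-fits {k} k≥1 seen block (x ∷ xs) seen≤k block⊆ with x ∈? seen | length seen <? k
  ... | yes x∈ | _ rewrite phasesGo-revisit k block xs x∈ =
    phasesGo-fits k≥1 seen (block ++ [ x ]) xs seen≤k (++⁺ block⊆ (x∈ ∷ []))
  ... | no x∉ | yes room rewrite phasesGo-admit k block xs x∉ room =
    phasesGo-fits k≥1 (x ∷ seen) (block ++ [ x ]) xs room (++⁺ (All.map there block⊆) (here refl ∷ []))
  ... | no x∉ | no full rewrite phasesGo-close k block xs x∉ full =
    (seen , seen≤k , block⊆) ∷ phasesGo-fits k≥1 [ x ] [ x ] xs k≥1 (here refl ∷ [])
  phasesGo-fits k≥1 seen []      []       seen≤k block⊆ = []
  phasesGo-fits k≥1 seen (_ ∷ _) []       seen≤k block⊆ = (seen , seen≤k , block⊆) ∷ []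

  length-phasesGo-[] : ∀ k seen block → length (phasesGo k seen block []) ≤ 1
  length-phasesGo-[] k seen []      = z≤n
  length-phasesGo-[] k seen (_ ∷ _) = s≤s z≤n

  -- The greedy state is compared with a cut of the remaining input into blocks fitting k nodes,
  -- u (or v) being the rest of the current block. Aligned: the running phase began inside the
  -- current block, so its nodes lie in that block's node set S and it cannot close before the
  -- block ends. Lagging: it began earlier; it closes at most once before the block ends and is
  -- aligned from then on.
  mutual
    length-phasesGo-aligned : ∀ {k} (B : List (List A)) (seen block : List A) {S u : List A} →
      length S ≤ k → Unique seen → All (_∈ S) seen → All (_∈ S) u → All (Fits k) B →
      length (phasesGo k seen block (u ++ concat B)) ≤ suc (length B)
    length-phasesGo-aligned {k} B seen block {u = x ∷ u} S≤k uniq seen⊆S (x∈S ∷ u⊆S) fits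
      with x ∈? seen | length seen <? k
    ... | yes x∈ | _ rewrite phasesGo-revisit k block (u ++ concat B) x∈ =
      length-phasesGo-aligned B seen (block ++ [ x ]) S≤k uniq seen⊆S u⊆S fits
    ... | no x∉ | yes room rewrite phasesGo-admit k block (u ++ concat B) x∉ room =
      length-phasesGo-aligned B (x ∷ seen) (block ++ [ x ]) S≤k
        (¬Any⇒All¬ seen x∉ ∷ uniq) (x∈S ∷ seen⊆S) u⊆S fits
    ... | no x∉ | no full =
      contradiction (≤-trans (Unique⇒length≤ (¬Any⇒All¬ seen x∉ ∷ uniq) (x∈S ∷ seen⊆S)) S≤k) full
    length-phasesGo-aligned {k} [] seen block {u = []} S≤k uniq seen⊆S [] [] =
      length-phasesGo-[] k seen block
    length-phasesGo-aligned (b ∷ B) seen block {u = []} S≤k uniq seen⊆S [] ((T , T≤k , b⊆T) ∷ fits) =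
      length-phasesGo-lagging B seen block T≤k (≤-trans (Unique⇒length≤ uniq seen⊆S) S≤k) b⊆T fits

    length-phasesGo-lagging : ∀ {k} (B : List (List A)) (seen block : List A) {S v : List A} →
      length S ≤ k → length seen ≤ k → All (_∈ S) v → All (Fits k) B →
      length (phasesGo k seen block (v ++ concat B)) ≤ 2 + length B
    length-phasesGo-lagging {k} B seen block {v = x ∷ v} S≤k seen≤k (x∈S ∷ v⊆S) fits
      with x ∈? seen | length seen <? k
    ... | yes x∈ | _ rewrite phasesGo-revisit k block (v ++ concat B) x∈ =
      length-phasesGo-lagging B seen (block ++ [ x ]) S≤k seen≤k v⊆S fits
    ... | no x∉ | yes room rewrite phasesGo-admit k block (v ++ concat B) x∉ room =
      length-phasesGo-lagging B (x ∷ seen) (block ++ [ x ]) S≤k room v⊆S fits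
    ... | no x∉ | no full rewrite phasesGo-close k block (v ++ concat B) x∉ full =
      s≤s (length-phasesGo-aligned B [ x ] [ x ] S≤k ([] ∷ []) (x∈S ∷ []) v⊆S fits)
    length-phasesGo-lagging {k} [] seen block {v = []} S≤k seen≤k [] [] =
      ≤-trans (length-phasesGo-[] k seen block) (n≤1+n 1)
    length-phasesGo-lagging (b ∷ B) seen block {v = []} S≤k seen≤k [] ((T , T≤k , b⊆T) ∷ fits) =
      ≤-trans (length-phasesGo-lagging B seen block T≤k seen≤k b⊆T fits) (s≤s (s≤s (n≤1+n _)))

  length-phases-minimal : ∀ {k} (B : List (List A)) → All (Fits k) B → length (phases k (concat B)) ≤ length B
  length-phases-minimal []      []                         = z≤n
  length-phases-minimal (b ∷ B) ((S , S≤k , b⊆S) ∷ fits) = length-phasesGo-aligned B [] [] S≤k [] [] b⊆S fits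

  newIn-cover : ∀ prev earlier xs {S} → All (_∈ S) prev → All (_∈ S) earlier →
                ∃[ S′ ] length S′ ≤ length S + newIn prev earlier xs × S ⊆ S′ × All (_∈ S′) xs
  newIn-cover prev earlier []       {S} prev⊆S earlier⊆S = S , ≤-reflexive (sym (+-identityʳ _)) , id , []
  newIn-cover prev earlier (x ∷ xs) {S} prev⊆S earlier⊆S with x ∈? earlier | x ∈? prev
  ... | yes x∈ | _ =
    let x∈S = All.lookup earlier⊆S x∈
        S′ , S′≤ , S⊆S′ , xs⊆S′ =
          newIn-cover prev (earlier ++ [ x ]) xs prev⊆S (++⁺ earlier⊆S (x∈S ∷ []))
    in S′ , S′≤ , S⊆S′ , S⊆S′ x∈S ∷ xs⊆S′
  ... | no _ | yes x∈ =
    let x∈S = All.lookup prev⊆S x∈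
        S′ , S′≤ , S⊆S′ , xs⊆S′ =
          newIn-cover prev (earlier ++ [ x ]) xs prev⊆S (++⁺ earlier⊆S (x∈S ∷ []))
    in S′ , S′≤ , S⊆S′ , S⊆S′ x∈S ∷ xs⊆S′
  ... | no _ | no _ =
    let S′ , S′≤ , x∷S⊆S′ , xs⊆S′ = newIn-cover prev (earlier ++ [ x ]) xs {x ∷ S}
          (All.map there prev⊆S) (++⁺ (All.map there earlier⊆S) (here refl ∷ []))
    in S′ , ≤-trans S′≤ (≤-reflexive (sym (+-suc (length S) _))) ,
       x∷S⊆S′ ∘ there , x∷S⊆S′ (here refl) ∷ xs⊆S′

  fits-++ : ∀ {k} p q → Fits k p → Fits (k + newIn p [] q) (p ++ q)
  fits-++ p q (S , S≤k , p⊆S) =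
    let S′ , S′≤ , S⊆S′ , q⊆S′ = newIn-cover p [] q p⊆S []
    in S′ , ≤-trans S′≤ (+-monoˡ-≤ _ S≤k) , ++⁺ (All.map S⊆S′ p⊆S) q⊆S′

  mutual
    pairUp : ℕ → List (List A) → List (List A)
    pairUp d []       = []
    pairUp d (p ∷ ps) = pairUpFrom d p ps

    pairUpFrom : ℕ → List A → List (List A) → List (List A)
    pairUpFrom d p []       = [ p ]
    pairUpFrom d p (q ∷ ps) with newIn p [] q ≤? d
    ... | yes _ = (p ++ q) ∷ pairUp d ps
    ... | no _  = p ∷ pairUpFrom d q ps

  mutual
    concat-pairUp : ∀ d P → concat (pairUp d P) ≡ concat P
    concat-pairUp d []       = refl
    concat-pairUp d (p ∷ ps) = concat-pairUpFrom d p ps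

    concat-pairUpFrom : ∀ d p ps → concat (pairUpFrom d p ps) ≡ p ++ concat ps
    concat-pairUpFrom d p []       = refl
    concat-pairUpFrom d p (q ∷ ps) with newIn p [] q ≤? d
    ... | yes _ = trans (++-assoc p q _) (cong ((p ++_) ∘ (q ++_)) (concat-pairUp d ps))
    ... | no _  = cong (p ++_) (concat-pairUpFrom d q ps)

  mutual
    pairUp-fits : ∀ {k} d P → All (Fits k) P → All (Fits (k + d)) (pairUp d P)
    pairUp-fits d []       []                = []
    pairUp-fits d (p ∷ ps) (p-fits ∷ ps-fits) = pairUpFrom-fits d p ps p-fits ps-fits

    pairUpFrom-fits : ∀ {k} d p ps → Fits k p → All (Fits k) ps → All (Fits (k + d)) (pairUpFrom d p ps)
    pairUpFrom-fits {k} d p []       p-fits []                 = fits-mono (m≤m+n k d) p-fits ∷ []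
    pairUpFrom-fits {k} d p (q ∷ ps) p-fits (q-fits ∷ ps-fits) with newIn p [] q ≤? d
    ... | yes new≤d = fits-mono (+-monoʳ-≤ k new≤d) (fits-++ p q p-fits) ∷ pairUp-fits d ps ps-fits
    ... | no _      = fits-mono (m≤m+n k d) p-fits ∷ pairUpFrom-fits d q ps q-fits ps-fits

  totalNew-∷ : ∀ q ps → totalNew ps ≤ totalNew (q ∷ ps)
  totalNew-∷ q []           = z≤n
  totalNew-∷ q (_ ∷ [])     = z≤n
  totalNew-∷ q (p ∷ p′ ∷ ps) = m≤n+m _ (newIn q [] p)

  -- Each block is charged 2(d + 1): a merged pair is paid by its two phases, and a phase
  -- left alone pays d + 1 itself and d + 1 out of the new requests of its successor.
  mutual
    length-pairUp : ∀ d P → length (pairUp d P) * (2 * suc d) ≤ suc (length P) * suc d + totalNew P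
    length-pairUp d []       = z≤n
    length-pairUp d (p ∷ ps) = length-pairUpFrom d p ps

    length-pairUpFrom : ∀ d p ps →
      length (pairUpFrom d p ps) * (2 * suc d) ≤ suc (length (p ∷ ps)) * suc d + totalNew (p ∷ ps)
    length-pairUpFrom d p []       = ≤-refl
    length-pairUpFrom d p (q ∷ ps) with newIn p [] q ≤? d
    ... | yes _ = begin
      2 * D + length (pairUp d ps) * (2 * D)
        ≤⟨ +-monoʳ-≤ (2 * D) (length-pairUp d ps) ⟩
      2 * D + (suc n * D + totalNew ps)
        ≡⟨ regroup D (suc n * D) (totalNew ps) ⟩
      (3 + n) * D + totalNew ps
        ≤⟨ +-monoʳ-≤ ((3 + n) * D) (≤-trans (totalNew-∷ q ps) (m≤n+m _ _)) ⟩
      (3 + n) * D + (newIn p [] q + totalNew (q ∷ ps))  ∎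
      where
      open ≤-Reasoning
      D = suc d
      n = length ps
      regroup : ∀ D X T → 2 * D + (X + T) ≡ D + (D + X) + T
      regroup = solve-∀
    ... | no new≰d = begin
      2 * D + length (pairUpFrom d q ps) * (2 * D)
        ≤⟨ +-monoʳ-≤ (2 * D) (length-pairUpFrom d q ps) ⟩
      2 * D + ((2 + n) * D + totalNew (q ∷ ps))
        ≡⟨ regroup D ((2 + n) * D) (totalNew (q ∷ ps)) ⟩
      (3 + n) * D + (D + totalNew (q ∷ ps))
        ≤⟨ +-monoʳ-≤ ((3 + n) * D) (+-monoˡ-≤ _ (≰⇒> new≰d)) ⟩
      (3 + n) * D + (newIn p [] q + totalNew (q ∷ ps))  ∎
      where
      open ≤-Reasoning
      D = suc d
      n = length ps
      regroup : ∀ D X T → 2 * D + (X + T) ≡ D + X + (D + T)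
      regroup = solve-∀

  totalNew≡0 : ∀ P → length P ∸ 1 ≡ 0 → totalNew P ≡ 0
  totalNew≡0 []          _  = refl
  totalNew≡0 (_ ∷ [])    _  = refl
  totalNew≡0 (_ ∷ _ ∷ _) ()

  m-budget : ∀ k k′ r → (+ k ℚ./ 1) ℚ.+ (+ 2 ℚ./ 1) ℚ.* m k r ℚ.≤ (+ k′ ℚ./ 1) →
             k ≤ k′ × 2 * totalNew (phases k r) ≤ ℓ k r * (k′ ∸ k)
  m-budget k k′ r H with ℓ k r in ℓ≡
  -- For ℓ = 0, m k r is 0ℚ, which is definitionally + 0 / 1.
  ... | zero  = proj₁ (budget-split k k′ 0 0 (fraction-budget k k′ 0 0 H)) ,
                ≤-reflexive (cong (2 *_) (totalNew≡0 (phases k r) ℓ≡))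
  ... | suc n = budget-split k k′ T n (fraction-budget k k′ T n H)
    where T = totalNew (phases k r)

  4*ℓ[k′]≤3*ℓ[k] : ∀ {k k′} r → 1 ≤ k → k ≤ k′ →
                   2 * totalNew (phases k r) ≤ ℓ k r * (k′ ∸ k) → 4 * ℓ k′ r ≤ 3 * ℓ k r
  4*ℓ[k′]≤3*ℓ[k] {k} {k′} r k≥1 k≤k′ few-new = begin
    4 * ℓ k′ r          ≤⟨ *-monoʳ-≤ 4 (∸-monoˡ-≤ 1 k′-phases≤B) ⟩
    4 * (length B ∸ 1)  ≤⟨ pairing-bound d (length P) (length B) (totalNew P) (length-pairUp d P) few-new ⟩
    3 * ℓ k r           ∎
    where
    open ≤-Reasoning
    d = k′ ∸ k
    P = phases k r
    B = pairUp d P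
    B-fits : All (Fits k′) B
    B-fits = subst (λ k″ → All (Fits k″) B) (m+[n∸m]≡n k≤k′)
                   (pairUp-fits d P (phasesGo-fits k≥1 [] [] r z≤n []))
    k′-phases≤B : length (phases k′ r) ≤ length B
    k′-phases≤B = subst (λ xs → length (phases k′ xs) ≤ length B)
                        (trans (concat-pairUp d P) (concat-phasesGo k [] [] r))
                        (length-phases-minimal B B-fits)

open import Defs
open import Data.List using (List)
open import Data.Nat using (ℕ; _≤_)
open import Data.Integer using (+_)
open import Data.Rational using (_/_; _+_; _*_)
open import Relation.Binary.Definitions using (DecidableEquality)
open import Data.Rational using () renaming (_≤_ to _≤ℚ_)
open import Data.Product using (_,_)

mainTheorem4 : {A : Set} (_≟_ : DecidableEquality A) (r : List A) (k : ℕ) → 1 ≤ k →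
    (k′ : ℕ) → ((+ k / 1) + ((+ 2 / 1) * Phases.m _≟_ k r)) ≤ℚ (+ k′ / 1) →
    (+ Phases.ℓ _≟_ k′ r / 1) ≤ℚ ((+ 3 / 4) * (+ Phases.ℓ _≟_ k r / 1))
mainTheorem4 _≟_ r k k≥1 k′ budget with PhaseBounds.m-budget _≟_ k k′ r budget
... | k≤k′ , few-new =
  Fractions.≤-three-quarters (Phases.ℓ _≟_ k′ r) (Phases.ℓ _≟_ k r)
    (PhaseBounds.4*ℓ[k′]≤3*ℓ[k] _≟_ r k≥1 k≤k′ few-new)
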